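{- For $n\geq 1$ let $D_n=\langle a,b\mid a^n=b^2=(ab)^2=1\rangle$ be the dihedral group of order $2n$. Then $D_n$ is a chirality group if and only if $n\leq 2$.
   Context: Let $\Delta=\langle r_0,r_1,r_2\mid r_0^2=r_1^2=r_2^2=1\rangle$ and let $\Delta^+$ be its index-$2$ subgroup of even-length words, generated by $\rho=r_1r_2$ and $\lambda=r_2r_0$. An (oriented) hypermap is a triple $(D,R,L)$ with $D$ a finite set and $R,L$ permutations of $D$ generating a group transitive on $D$ (the monodromy group). It is orientably regular if its automorphism group (permutations of $D$ commuting with $R$ and $L$) acts regularly on $D$; orientably regular hypermaps correspond (up to isomorphism) bijectively to normal subgroups $H$ of finite index in $\Delta^+$ (hypermap subgroups), the hypermap being $(\Delta^+/H,\rho,\lambda)$ acting by left multiplication. For $H\trianglelefteq\Delta^+$ put $H^r=r_2Hr_2$. The chirality group of the hypermap is $HH^r/H$ (isomorphic to $H/(H\cap H^r)$). A group $G$ is called a chirality group if $G$ is isomorphic to the chirality group of some orientably regular hypermap. -}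

module Defs where

open import Data.Nat using (ℕ; suc; _+_; _∸_; _≤_; NonZero)
open import Data.Nat.DivMod using (_mod_)
open import Data.Fin using (Fin; toℕ)
open import Data.Fin.Permutation using (Permutation′; _⟨$⟩ʳ_; _⟨$⟩ˡ_)
open import Data.Bool using (Bool; true; false; if_then_else_; _xor_)
open import Data.Product using (_×_; _,_; Σ; ∃; ∃-syntax)
open import Data.List using (List; []; _∷_)
open import Function using (id; _∘_)
open import Relation.Binary.PropositionalEquality using (_≡_)

-- Δ⁺ is free on ρ = r₁r₂ and λ = r₂r₀; its elements are represented by
-- (not necessarily reduced) words in ρ^{±1}, λ^{±1}.

data Letter : Set where
  ρ⁺ ρ⁻ λ⁺ λ⁻ : Letter

Word : Set
Word = List Letter

-- Action of a word of Δ⁺ on the darts Fin m of the hypermap (Fin m, R, L):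
-- ρ acts as R, λ acts as L (left action: the first letter acts last).
actL : ∀ {m} → Permutation′ m → Permutation′ m → Letter → Fin m → Fin m
actL R L ρ⁺ = R ⟨$⟩ʳ_
actL R L ρ⁻ = R ⟨$⟩ˡ_
actL R L λ⁺ = L ⟨$⟩ʳ_
actL R L λ⁻ = L ⟨$⟩ˡ_

eval : ∀ {m} → Permutation′ m → Permutation′ m → Word → Fin m → Fin m
eval R L []      = id
eval R L (l ∷ w) = actL R L l ∘ eval R L w

-- conjugation by r₂ : ρ ↦ ρ⁻¹, λ ↦ λ⁻¹  (r₂ r₁ r₂ r₂ = r₂ r₁, r₂ r₂ r₀ r₂ = r₀ r₂)
conjLetter : Letter → Letter
conjLetter ρ⁺ = ρ⁻
conjLetter ρ⁻ = ρ⁺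
conjLetter λ⁺ = λ⁻
conjLetter λ⁻ = λ⁺

conjW : Word → Word
conjW []      = []
conjW (l ∷ w) = conjLetter l ∷ conjW w

_≈_ : ∀ {m} → (Fin m → Fin m) → (Fin m → Fin m) → Set
f ≈ g = ∀ x → f x ≡ g x

Transitive : ∀ {m} → Permutation′ m → Permutation′ m → Set
Transitive R L = ∀ d d′ → ∃[ w ] eval R L w d ≡ d′

IsAut : ∀ {m} → Permutation′ m → Permutation′ m → Permutation′ m → Set
IsAut R L φ = (∀ x → φ ⟨$⟩ʳ (R ⟨$⟩ʳ x) ≡ R ⟨$⟩ʳ (φ ⟨$⟩ʳ x))
            × (∀ x → φ ⟨$⟩ʳ (L ⟨$⟩ʳ x) ≡ L ⟨$⟩ʳ (φ ⟨$⟩ʳ x))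

OrientablyRegular : ∀ {m} → Permutation′ m → Permutation′ m → Set
OrientablyRegular {m} R L =
  (∀ d d′ → Σ (Permutation′ m) λ φ → IsAut R L φ × φ ⟨$⟩ʳ d ≡ d′)
  × (∀ φ → IsAut R L φ → ∀ d → φ ⟨$⟩ʳ d ≡ d → ∀ x → φ ⟨$⟩ʳ x ≡ x)

record OrRegHypermap : Set where
  field
    m        : ℕ
    nonempty : 1 ≤ m
    R L      : Permutation′ m
    trans    : Transitive R L
    regular  : OrientablyRegular R L

-- Hypermap subgroup H = {w | w acts trivially} (kernel = dart stabiliser,
-- the hypermap being regular), H^r = r₂ H r₂ = {w | conjW w ∈ H}.
-- The chirality group HH^r/H is realised inside Δ⁺/H ≅ Mon = ⟨R,L⟩ as the
-- image of H^r: elements f of Sym(D) with f = eval w for some w ∈ H^r.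
InChirality : (M : OrRegHypermap) → (Fin (OrRegHypermap.m M) → Fin (OrRegHypermap.m M)) → Set
InChirality M f = ∃[ w ] (eval R L w ≈ f × eval R L (conjW w) ≈ id)
  where open OrRegHypermap M

IsoToChirality : {A : Set} → (A → A → A) → OrRegHypermap → Set
IsoToChirality {A} _·_ M =
  Σ (A → Fin m → Fin m) λ φ →
      (∀ g h → φ (g · h) ≈ (φ g ∘ φ h))
    × (∀ g h → φ g ≈ φ h → g ≡ h)
    × (∀ g → InChirality M (φ g))
    × (∀ f → InChirality M f → ∃[ g ] φ g ≈ f)
  where open OrRegHypermap M

IsChiralityGroup : {A : Set} → (A → A → A) → Set
IsChiralityGroup _·_ = ∃[ M ] IsoToChirality _·_ M

-- Dihedral group D_n of order 2n: (k , s) stands for a^k b^s (a rotation of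
-- order n, b a reflection, b a b = a⁻¹).

Dih : ℕ → Set
Dih n = Fin n × Bool

dihMul : (n : ℕ) .{{_ : NonZero n}} → Dih n → Dih n → Dih n
dihMul n (i , s) (j , t) =
  ((toℕ i + (if s then n ∸ toℕ j else toℕ j)) mod n) , (s xor t)

module Submission where

-- Let φ embed D_n (n ≥ 3) as the chirality group of an orientably regular hypermap, and put
-- A = φ(a). The chirality group is normal in the monodromy group, so conjugating A by a letter
-- of Δ⁺ gives an element of φ(D_n) which, like A, is not an involution; hence it is a power A^c.
-- The exponent is multiplicative along words, and the mirror image (conjugation by r₂) of a
-- letter is its inverse, so for every word w with mirror w̄ the exponents satisfy A^(c̄ c) = A.
-- If w represents φ(b), then w̄ acts trivially, so c̄ and hence c act trivially on A: φ(b)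
-- commutes with φ(a), which fails in D_n for n ≥ 3.
-- For n = 1, 2 the group is realised by explicit regular hypermaps with 64 and 96 darts. Each
-- has a reflexible quotient (with 32 resp. 24 darts): a mirror symmetry θ of the quotient fixing
-- the image of the base dart d₀ turns "w̄ fixes d₀" into "w d₀ lies in the fibre of d₀", so the
-- chirality group is read off from that fibre, which consists of the 2n darts of the listed words.

open import Defs
open import Data.Nat using (ℕ; zero; suc; _+_; _*_; _∸_; _<_; _≤_; _%_; s≤s; z≤n; NonZero; nonZero)
open import Data.Nat.Properties using (*-comm; [m*n]*[o*p]≡[m*o]*[n*p]; m+[n∸m]≡n; <⇒≤; ≤-refl; ≤-trans; n≤1+n)
open import Data.Nat.DivMod using (_mod_; m<n⇒m%n≡m; n%n≡0)
open import Data.Fin using (Fin; toℕ; fromℕ<; quotient; combine; #_) renaming (zero to fzero; suc to fsuc)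
open import Data.Fin.Properties using (toℕ-injective; toℕ-fromℕ<; fromℕ<-toℕ; toℕ<n; all?; _≟_)
open import Data.Fin.Permutation
  using (Permutation′; permutation; _⟨$⟩ʳ_; _⟨$⟩ˡ_; inverseʳ; inverseˡ; flip; _∘ₚ_) renaming (id to idₚ)
open import Data.Bool using (true; false)
open import Data.Bool.Properties using () renaming (_≟_ to _≟ᵇ_)
open import Data.Product using (_×_; _,_; Σ; ∃-syntax; proj₁; proj₂)
open import Data.Product.Properties using (≡-dec)
open import Data.List using ([]; _∷_; _++_)
open import Data.Vec using (Vec; lookup; []; _∷_)
open import Data.Empty using (⊥; ⊥-elim)
open import Function using (id; _∘_)
open import Relation.Nullary using (¬_; Dec)
open import Relation.Nullary.Decidable using (True; toWitness; map′; _×-dec_; _→-dec_)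
open import Relation.Binary.PropositionalEquality

conjLetter-involutive : ∀ l → conjLetter (conjLetter l) ≡ l
conjLetter-involutive ρ⁺ = refl
conjLetter-involutive ρ⁻ = refl
conjLetter-involutive λ⁺ = refl
conjLetter-involutive λ⁻ = refl

conjW-++ : ∀ u v → conjW (u ++ v) ≡ conjW u ++ conjW v
conjW-++ []      v = refl
conjW-++ (l ∷ u) v = cong (conjLetter l ∷_) (conjW-++ u v)

inverseWord : Word → Word
inverseWord []      = []
inverseWord (l ∷ w) = inverseWord w ++ conjLetter l ∷ []

infixr 10 _^_

_^_ : {A : Set} → (A → A) → ℕ → A → A
(f ^ zero)  x = x
(f ^ suc k) x = f ((f ^ k) x)

module _ {A : Set} where

  ^-+ : ∀ (f : A → A) i j → f ^ (i + j) ≗ f ^ i ∘ f ^ j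
  ^-+ f zero    j x = refl
  ^-+ f (suc i) j x = cong f (^-+ f i j x)

  ^-* : ∀ (f : A → A) i j → f ^ (j * i) ≗ (f ^ i) ^ j
  ^-* f i zero    x = refl
  ^-* f i (suc j) x = trans (^-+ f i (j * i) x) (cong (f ^ i) (^-* f i j x))

  ^-cong : ∀ {f g : A → A} → f ≗ g → ∀ k → f ^ k ≗ g ^ k
  ^-cong f≗g zero    x = refl
  ^-cong {f} f≗g (suc k) x = trans (cong f (^-cong f≗g k x)) (f≗g _)

  ^-*-fixed : ∀ {f : A → A} {i j} → f ^ i ≗ f → f ^ j ≗ f → f ^ (i * j) ≗ f
  ^-*-fixed {f} {i} {j} fi≗f fj≗f x =
    trans (^-* f j i x) (trans (^-cong fj≗f i x) (fi≗f x))

  ^-intertwine : ∀ {h f g : A → A} → h ∘ f ≗ g ∘ h → ∀ k → h ∘ f ^ k ≗ g ^ k ∘ h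
  ^-intertwine hf≗gh zero    x = refl
  ^-intertwine {g = g} hf≗gh (suc k) x = trans (hf≗gh _) (cong g (^-intertwine hf≗gh k x))

module _ {m : ℕ} (R L : Permutation′ m) where

  actL-conjLetterʳ : ∀ l → actL R L l ∘ actL R L (conjLetter l) ≗ id
  actL-conjLetterʳ ρ⁺ x = inverseʳ R
  actL-conjLetterʳ ρ⁻ x = inverseˡ R
  actL-conjLetterʳ λ⁺ x = inverseʳ L
  actL-conjLetterʳ λ⁻ x = inverseˡ L

  actL-conjLetterˡ : ∀ l → actL R L (conjLetter l) ∘ actL R L l ≗ id
  actL-conjLetterˡ l x =
    trans (cong (λ l′ → actL R L (conjLetter l) (actL R L l′ x)) (sym (conjLetter-involutive l)))
          (actL-conjLetterʳ (conjLetter l) x)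

  actL-intertwines-conjugate : ∀ l (g : Fin m → Fin m) →
    actL R L l ∘ g ≗ (actL R L l ∘ g ∘ actL R L (conjLetter l)) ∘ actL R L l
  actL-intertwines-conjugate l g x = cong (actL R L l ∘ g) (sym (actL-conjLetterˡ l x))

  conjugate-involutive⇒involutive : ∀ l (g : Fin m → Fin m) →
    (actL R L l ∘ g ∘ actL R L (conjLetter l)) ^ 2 ≗ id → g ^ 2 ≗ id
  conjugate-involutive⇒involutive l g gˡ²≗id x = begin
    g (g x)                      ≡⟨ actL-conjLetterˡ l _ ⟨
    l̄ (actL R L l (g (g x)))     ≡⟨ cong l̄ (^-intertwine {g = gˡ} (actL-intertwines-conjugate l g) 2 x) ⟩
    l̄ ((gˡ ^ 2) (actL R L l x))  ≡⟨ cong l̄ (gˡ²≗id _) ⟩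
    l̄ (actL R L l x)             ≡⟨ actL-conjLetterˡ l x ⟩
    x                            ∎
    where
      open ≡-Reasoning
      l̄ = actL R L (conjLetter l)
      gˡ = actL R L l ∘ g ∘ l̄

  eval-++ : ∀ u v → eval R L (u ++ v) ≗ eval R L u ∘ eval R L v
  eval-++ []      v x = refl
  eval-++ (l ∷ u) v x = cong (actL R L l) (eval-++ u v x)

  eval-inverseWord : ∀ w → eval R L (inverseWord w) ∘ eval R L w ≗ id
  eval-inverseWord []      x = refl
  eval-inverseWord (l ∷ w) x = begin
    eval R L (inverseWord w ++ conjLetter l ∷ []) (actL R L l (eval R L w x))
      ≡⟨ eval-++ (inverseWord w) _ _ ⟩
    eval R L (inverseWord w) (actL R L (conjLetter l) (actL R L l (eval R L w x)))
      ≡⟨ cong (eval R L (inverseWord w)) (actL-conjLetterˡ l _) ⟩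
    eval R L (inverseWord w) (eval R L w x)
      ≡⟨ eval-inverseWord w x ⟩
    x ∎
    where open ≡-Reasoning

  eval-idempotent⇒id : ∀ w → eval R L w ∘ eval R L w ≗ eval R L w → eval R L w ≗ id
  eval-idempotent⇒id w idem x = begin
    eval R L w x                                      ≡⟨ eval-inverseWord w _ ⟨
    eval R L (inverseWord w) (eval R L w (eval R L w x)) ≡⟨ cong (eval R L (inverseWord w)) (idem x) ⟩
    eval R L (inverseWord w) (eval R L w x)             ≡⟨ eval-inverseWord w x ⟩
    x ∎
    where open ≡-Reasoning

  eval-mirror : ∀ w → eval (flip R) (flip L) w ≗ eval R L (conjW w)
  eval-mirror []       x = refl
  eval-mirror (ρ⁺ ∷ w) x = cong (R ⟨$⟩ˡ_) (eval-mirror w x)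
  eval-mirror (ρ⁻ ∷ w) x = cong (R ⟨$⟩ʳ_) (eval-mirror w x)
  eval-mirror (λ⁺ ∷ w) x = cong (L ⟨$⟩ˡ_) (eval-mirror w x)
  eval-mirror (λ⁻ ∷ w) x = cong (L ⟨$⟩ʳ_) (eval-mirror w x)

Equivariant : ∀ {m k} → (R L : Permutation′ m) (R′ L′ : Permutation′ k) → (Fin m → Fin k) → Set
Equivariant R L R′ L′ f = (∀ x → f (R ⟨$⟩ʳ x) ≡ R′ ⟨$⟩ʳ f x) × (∀ x → f (L ⟨$⟩ʳ x) ≡ L′ ⟨$⟩ʳ f x)

commutes-inverse : ∀ {m k} (P : Permutation′ m) (P′ : Permutation′ k) {f : Fin m → Fin k} →
                   (∀ x → f (P ⟨$⟩ʳ x) ≡ P′ ⟨$⟩ʳ f x) → ∀ x → f (P ⟨$⟩ˡ x) ≡ P′ ⟨$⟩ˡ f x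
commutes-inverse P P′ {f} comm x = begin
  f (P ⟨$⟩ˡ x)                   ≡⟨ inverseˡ P′ ⟨
  P′ ⟨$⟩ˡ (P′ ⟨$⟩ʳ f (P ⟨$⟩ˡ x)) ≡⟨ cong (P′ ⟨$⟩ˡ_) (comm (P ⟨$⟩ˡ x)) ⟨
  P′ ⟨$⟩ˡ f (P ⟨$⟩ʳ (P ⟨$⟩ˡ x)) ≡⟨ cong (λ y → P′ ⟨$⟩ˡ f y) (inverseʳ P) ⟩
  P′ ⟨$⟩ˡ f x ∎
  where open ≡-Reasoning

module _ {m k} {R L : Permutation′ m} {R′ L′ : Permutation′ k} {f : Fin m → Fin k}
         (f-equivariant : Equivariant R L R′ L′ f) where

  equivariant-actL : ∀ l x → f (actL R L l x) ≡ actL R′ L′ l (f x)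
  equivariant-actL ρ⁺ = proj₁ f-equivariant
  equivariant-actL ρ⁻ = commutes-inverse R R′ (proj₁ f-equivariant)
  equivariant-actL λ⁺ = proj₂ f-equivariant
  equivariant-actL λ⁻ = commutes-inverse L L′ (proj₂ f-equivariant)

  equivariant-eval : ∀ w x → f (eval R L w x) ≡ eval R′ L′ w (f x)
  equivariant-eval []      x = refl
  equivariant-eval (l ∷ w) x = trans (equivariant-actL l _) (cong (actL R′ L′ l) (equivariant-eval w x))

module _ (M : OrRegHypermap) where
  open OrRegHypermap M using (R; L)

  InChirality-conjugate : ∀ {f} l → InChirality M f →
                          InChirality M (actL R L l ∘ f ∘ actL R L (conjLetter l))
  InChirality-conjugate {f} l (w , w≈f , w̄≈id) = l ∷ w ++ l̄ ∷ [] , conjugated , mirror-trivial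
    where
      l̄ = conjLetter l
      conjugated : eval R L (l ∷ w ++ l̄ ∷ []) ≗ actL R L l ∘ f ∘ actL R L l̄
      conjugated x = cong (actL R L l) (trans (eval-++ R L w _ x) (w≈f _))
      mirror-trivial : eval R L (conjW (l ∷ w ++ l̄ ∷ [])) ≗ id
      mirror-trivial x = begin
        actL R L l̄ (eval R L (conjW (w ++ l̄ ∷ [])) x)
          ≡⟨ cong (λ v → actL R L l̄ (eval R L v x)) (conjW-++ w (l̄ ∷ [])) ⟩
        actL R L l̄ (eval R L (conjW w ++ conjLetter l̄ ∷ []) x)
          ≡⟨ cong (actL R L l̄) (eval-++ R L (conjW w) _ x) ⟩
        actL R L l̄ (eval R L (conjW w) (actL R L (conjLetter l̄) x))
          ≡⟨ cong (actL R L l̄) (w̄≈id _) ⟩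
        actL R L l̄ (actL R L (conjLetter l̄) x)
          ≡⟨ actL-conjLetterʳ R L l̄ x ⟩
        x ∎
        where open ≡-Reasoning

dihMul-reflection² : ∀ n (j : Fin (suc n)) → dihMul (suc n) (j , true) (j , true) ≡ (fzero , false)
dihMul-reflection² n j = cong (_, false) (toℕ-injective (begin
  toℕ ((toℕ j + (suc n ∸ toℕ j)) mod suc n) ≡⟨ toℕ-fromℕ< _ ⟩
  (toℕ j + (suc n ∸ toℕ j)) % suc n         ≡⟨ cong (_% suc n) (m+[n∸m]≡n (<⇒≤ (toℕ<n j))) ⟩
  suc n % suc n                             ≡⟨ n%n≡0 (suc n) ⟩
  0                                         ∎))
  where open ≡-Reasoning

dihMul-a-rotation : ∀ n {j} (j<n : j < suc (suc n)) (1+j<n : suc j < suc (suc n)) →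
  dihMul (suc (suc n)) (fsuc fzero , false) (fromℕ< j<n , false) ≡ (fromℕ< 1+j<n , false)
dihMul-a-rotation n {j} j<n 1+j<n = cong (_, false) (toℕ-injective (begin
  toℕ ((suc (toℕ (fromℕ< j<n))) mod suc (suc n)) ≡⟨ toℕ-fromℕ< _ ⟩
  suc (toℕ (fromℕ< j<n)) % suc (suc n)           ≡⟨ cong (λ i → suc i % suc (suc n)) (toℕ-fromℕ< j<n) ⟩
  suc j % suc (suc n)                            ≡⟨ m<n⇒m%n≡m 1+j<n ⟩
  suc j                                          ≡⟨ toℕ-fromℕ< 1+j<n ⟨
  toℕ (fromℕ< 1+j<n)                             ∎))
  where open ≡-Reasoning

dihMul-a-a≢e : ∀ n → dihMul (3 + n) (fsuc fzero , false) (fsuc fzero , false) ≢ (fzero , false)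
dihMul-a-a≢e n ()

dihMul-b-a≢a-b : ∀ n → dihMul (3 + n) (fzero , true) (fsuc fzero , false)
                     ≢ dihMul (3 + n) (fsuc fzero , false) (fzero , true)
dihMul-b-a≢a-b n b·a≡a·b = 2+n≢1 (begin
  suc (suc n)                                                       ≡⟨ m<n⇒m%n≡m {n = 3 + n} ≤-refl ⟨
  suc (suc n) % (3 + n)                                             ≡⟨ toℕ-fromℕ< _ ⟨
  toℕ (proj₁ (dihMul (3 + n) (fzero , true) (fsuc fzero , false))) ≡⟨ cong (toℕ ∘ proj₁) b·a≡a·b ⟩
  1                                                                 ∎)
  where
    open ≡-Reasoning
    2+n≢1 : suc (suc n) ≢ 1
    2+n≢1 ()

module NotChirality (k : ℕ) (M : OrRegHypermap)
  (φ : Dih (3 + k) → Fin (OrRegHypermap.m M) → Fin (OrRegHypermap.m M))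
  (φ-hom : ∀ x y → φ (dihMul (3 + k) x y) ≈ (φ x ∘ φ y))
  (φ-injective : ∀ x y → φ x ≈ φ y → x ≡ y)
  (φ-chiral : ∀ x → InChirality M (φ x))
  (φ-onto : ∀ f → InChirality M f → ∃[ x ] φ x ≈ f) where

  open OrRegHypermap M using (m; R; L)

  n : ℕ
  n = 3 + k

  e a b : Dih n
  e = fzero , false
  a = fsuc fzero , false
  b = fzero , true

  act : Letter → Fin m → Fin m
  act = actL R L

  A : Fin m → Fin m
  A = φ a

  φ-e : φ e ≗ id
  φ-e x with φ-chiral e
  ... | w , w≗φe , _ = trans (sym (w≗φe x)) (eval-idempotent⇒id R L w idempotent x)
    where
      idempotent : eval R L w ∘ eval R L w ≗ eval R L w
      idempotent y = begin
        eval R L w (eval R L w y) ≡⟨ trans (w≗φe _) (cong (φ e) (w≗φe y)) ⟩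
        φ e (φ e y)               ≡⟨ φ-hom e e y ⟨
        φ e y                     ≡⟨ w≗φe y ⟨
        eval R L w y              ∎
        where open ≡-Reasoning

  φ-rotation : ∀ j (j<n : j < n) → φ (fromℕ< j<n , false) ≗ A ^ j
  φ-rotation zero    j<n   x = φ-e x
  φ-rotation (suc j) 1+j<n x = begin
    φ (fromℕ< 1+j<n , false) x                  ≡⟨ cong (λ y → φ y x) (dihMul-a-rotation (suc k) j<n 1+j<n) ⟨
    φ (dihMul n a (fromℕ< j<n , false)) x       ≡⟨ φ-hom a _ x ⟩
    A (φ (fromℕ< j<n , false) x)                ≡⟨ cong A (φ-rotation j j<n x) ⟩
    A ((A ^ j) x)                               ∎
    where
      open ≡-Reasoning
      j<n = ≤-trans (n≤1+n (suc j)) 1+j<n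

  φ-rotation-toℕ : ∀ (j : Fin n) → φ (j , false) ≗ A ^ toℕ j
  φ-rotation-toℕ j x = trans (cong (λ i → φ (i , false) x) (sym (fromℕ<-toℕ j (toℕ<n j))))
                          (φ-rotation (toℕ j) (toℕ<n j) x)

  φ-reflection² : ∀ j → φ (j , true) ^ 2 ≗ id
  φ-reflection² j x = begin
    φ (j , true) (φ (j , true) x)        ≡⟨ φ-hom (j , true) (j , true) x ⟨
    φ (dihMul n (j , true) (j , true)) x ≡⟨ cong (λ y → φ y x) (dihMul-reflection² (2 + k) j) ⟩
    φ e x                                ≡⟨ φ-e x ⟩
    x                                    ∎
    where open ≡-Reasoning

  A²≢id : ¬ (A ^ 2 ≗ id)
  A²≢id A²≗id = dihMul-a-a≢e k (φ-injective _ _ λ x →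
    trans (φ-hom a a x) (trans (A²≗id x) (sym (φ-e x))))

  letter-normalises-A : ∀ l → ∃[ c ] (act l ∘ A ≗ A ^ c ∘ act l)
  letter-normalises-A l with φ-onto _ (InChirality-conjugate M l (φ-chiral a))
  ... | (j , false) , φx≗Aˡ =
    toℕ j , λ x → trans (actL-intertwines-conjugate R L l A x) (trans (sym (φx≗Aˡ _)) (φ-rotation-toℕ j _))
  ... | (j , true)  , φx≗Aˡ =
    ⊥-elim (A²≢id (conjugate-involutive⇒involutive R L l A λ x →
      trans (^-cong (λ y → sym (φx≗Aˡ y)) 2 x) (φ-reflection² j x)))

  ConjugatesA : (Fin m → Fin m) → ℕ → Set
  ConjugatesA g c = g ∘ A ≗ A ^ c ∘ g

  ConjugatesA-∘ : ∀ f g c d → ConjugatesA f c → ConjugatesA g d → ConjugatesA (f ∘ g) (d * c)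
  ConjugatesA-∘ f g c d f-conj g-conj x = begin
    f (g (A x))           ≡⟨ cong f (g-conj x) ⟩
    f ((A ^ d) (g x))     ≡⟨ ^-intertwine {h = f} f-conj d (g x) ⟩
    ((A ^ c) ^ d) (f (g x)) ≡⟨ ^-* A c d _ ⟨
    (A ^ (d * c)) (f (g x)) ∎
    where open ≡-Reasoning

  record MirrorExponents (w : Word) : Set where
    field
      c c̄         : ℕ
      conjugates        : ConjugatesA (eval R L w) c
      mirror-conjugates : ConjugatesA (eval R L (conjW w)) c̄
      exponents-inverse : A ^ (c̄ * c) ≗ A

  mirrorExponents-letter : ∀ l → MirrorExponents (l ∷ [])
  mirrorExponents-letter l with letter-normalises-A l | letter-normalises-A (conjLetter l)
  ... | c , l-conj | c̄ , l̄-conj = record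
    { c = c ; c̄ = c̄ ; conjugates = l-conj ; mirror-conjugates = l̄-conj
    ; exponents-inverse = λ x → begin
        (A ^ (c̄ * c)) x                         ≡⟨ ^-* A c c̄ x ⟩
        ((A ^ c) ^ c̄) x                         ≡⟨ cong ((A ^ c) ^ c̄) (actL-conjLetterʳ R L l x) ⟨
        ((A ^ c) ^ c̄) (act l (act l̄ x))         ≡⟨ ^-intertwine {h = act l} l-conj c̄ _ ⟨
        act l ((A ^ c̄) (act l̄ x))               ≡⟨ cong (act l) (l̄-conj x) ⟨
        act l (act l̄ (A x))                     ≡⟨ actL-conjLetterʳ R L l (A x) ⟩
        A x                                     ∎ }
    where
      open ≡-Reasoning
      l̄ = conjLetter l

  mirrorExponents : ∀ w → MirrorExponents w
  mirrorExponents []      = record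
    { c = 1 ; c̄ = 1
    ; conjugates = λ _ → refl ; mirror-conjugates = λ _ → refl ; exponents-inverse = λ _ → refl }
  mirrorExponents (l ∷ w) = record
    { c = Eʷ.c * Eˡ.c ; c̄ = Eʷ.c̄ * Eˡ.c̄
    ; conjugates = ConjugatesA-∘ (act l) (eval R L w) Eˡ.c Eʷ.c Eˡ.conjugates Eʷ.conjugates
    ; mirror-conjugates =
        ConjugatesA-∘ (act (conjLetter l)) (eval R L (conjW w)) Eˡ.c̄ Eʷ.c̄ Eˡ.mirror-conjugates Eʷ.mirror-conjugates
    ; exponents-inverse = λ x → trans
        (cong (λ i → (A ^ i) x) ([m*n]*[o*p]≡[m*o]*[n*p] Eʷ.c̄ Eˡ.c̄ Eʷ.c Eˡ.c))
        (^-*-fixed {i = Eʷ.c̄ * Eʷ.c} {j = Eˡ.c̄ * Eˡ.c} Eʷ.exponents-inverse Eˡ.exponents-inverse x) }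
    where
      module Eˡ = MirrorExponents (mirrorExponents-letter l)
      module Eʷ = MirrorExponents (mirrorExponents w)

  chirality-centralises-A : ∀ {f} → InChirality M f → f ∘ A ≗ A ∘ f
  chirality-centralises-A {f} (w , w≗f , w̄≗id) x = begin
    f (A x)                    ≡⟨ w≗f (A x) ⟨
    eval R L w (A x)           ≡⟨ conjugates x ⟩
    (A ^ c) (eval R L w x)     ≡⟨ Aᶜ≗A _ ⟩
    A (eval R L w x)           ≡⟨ cong A (w≗f x) ⟩
    A (f x)                    ∎
    where
      open ≡-Reasoning
      open MirrorExponents (mirrorExponents w)
      A≗Aᶜ̄ : A ≗ A ^ c̄
      A≗Aᶜ̄ y = begin
        A y                                 ≡⟨ w̄≗id (A y) ⟨
        eval R L (conjW w) (A y)            ≡⟨ mirror-conjugates y ⟩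
        (A ^ c̄) (eval R L (conjW w) y)      ≡⟨ cong (A ^ c̄) (w̄≗id y) ⟩
        (A ^ c̄) y                           ∎
      Aᶜ≗A : A ^ c ≗ A
      Aᶜ≗A y = begin
        (A ^ c) y          ≡⟨ ^-cong A≗Aᶜ̄ c y ⟩
        ((A ^ c̄) ^ c) y    ≡⟨ ^-* A c̄ c y ⟨
        (A ^ (c * c̄)) y    ≡⟨ cong (λ i → (A ^ i) y) (*-comm c c̄) ⟩
        (A ^ (c̄ * c)) y    ≡⟨ exponents-inverse y ⟩
        A y                ∎

  absurd : ⊥
  absurd = dihMul-b-a≢a-b k (φ-injective _ _ λ x → begin
    φ (dihMul n b a) x  ≡⟨ φ-hom b a x ⟩
    φ b (A x)           ≡⟨ chirality-centralises-A (φ-chiral b) x ⟩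
    A (φ b x)           ≡⟨ φ-hom a b x ⟨
    φ (dihMul n a b) x  ∎)
    where open ≡-Reasoning

dihedral-not-chirality-group : ∀ k → ¬ IsChiralityGroup (dihMul (3 + k))
dihedral-not-chirality-group k (M , φ , hom , inj , chiral , onto) =
  NotChirality.absurd k M φ hom inj chiral onto

flip-agrees : ∀ {m} (P φ : Permutation′ m) {d} → (∀ x → φ ⟨$⟩ʳ (P ⟨$⟩ʳ x) ≡ P ⟨$⟩ʳ (φ ⟨$⟩ʳ x)) →
              φ ⟨$⟩ʳ d ≡ P ⟨$⟩ʳ d → flip φ ⟨$⟩ʳ d ≡ P ⟨$⟩ˡ d
flip-agrees P φ {d} φ-P φd≡Pd = begin
  φ ⟨$⟩ˡ d                        ≡⟨ cong (φ ⟨$⟩ˡ_) (inverseˡ P) ⟨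
  φ ⟨$⟩ˡ (P ⟨$⟩ˡ (P ⟨$⟩ʳ d))        ≡⟨ cong (λ y → φ ⟨$⟩ˡ (P ⟨$⟩ˡ y)) φd≡Pd ⟨
  φ ⟨$⟩ˡ (P ⟨$⟩ˡ (φ ⟨$⟩ʳ d))        ≡⟨ cong (φ ⟨$⟩ˡ_) (commutes-inverse P P {φ ⟨$⟩ʳ_} φ-P d) ⟨
  φ ⟨$⟩ˡ (φ ⟨$⟩ʳ (P ⟨$⟩ˡ d))        ≡⟨ inverseˡ φ ⟩
  P ⟨$⟩ˡ d                        ∎
  where open ≡-Reasoning

module Automorphisms {m : ℕ} (R L : Permutation′ m) where

  IsAut-id : IsAut R L idₚ
  IsAut-id = (λ _ → refl) , (λ _ → refl)

  IsAut-∘ₚ : ∀ φ χ → IsAut R L φ → IsAut R L χ → IsAut R L (φ ∘ₚ χ)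
  IsAut-∘ₚ φ χ (φ-R , φ-L) (χ-R , χ-L) =
    (λ x → trans (cong (χ ⟨$⟩ʳ_) (φ-R x)) (χ-R _)) , (λ x → trans (cong (χ ⟨$⟩ʳ_) (φ-L x)) (χ-L _))

  IsAut-flip : ∀ φ → IsAut R L φ → IsAut R L (flip φ)
  IsAut-flip φ (φ-R , φ-L) = (λ x → sym (commutes-inverse φ φ {R ⟨$⟩ʳ_} (λ y → sym (φ-R y)) x))
                             , (λ x → sym (commutes-inverse φ φ {L ⟨$⟩ʳ_} (λ y → sym (φ-L y)) x))

module RegularHypermap {m : ℕ} (R L : Permutation′ m) (d₀ : Fin m)
  (path : Fin m → Word) (path-reaches : ∀ d → eval R L (path d) d₀ ≡ d)
  (ψR ψL : Permutation′ m) (ψR-aut : IsAut R L ψR) (ψL-aut : IsAut R L ψL)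
  (ψR-d₀ : ψR ⟨$⟩ʳ d₀ ≡ R ⟨$⟩ʳ d₀) (ψL-d₀ : ψL ⟨$⟩ʳ d₀ ≡ L ⟨$⟩ʳ d₀) where

  open Automorphisms R L

  ψ : Letter → Permutation′ m
  ψ ρ⁺ = ψR
  ψ ρ⁻ = flip ψR
  ψ λ⁺ = ψL
  ψ λ⁻ = flip ψL

  ψ-aut : ∀ l → IsAut R L (ψ l)
  ψ-aut ρ⁺ = ψR-aut
  ψ-aut ρ⁻ = IsAut-flip ψR ψR-aut
  ψ-aut λ⁺ = ψL-aut
  ψ-aut λ⁻ = IsAut-flip ψL ψL-aut

  ψ-d₀ : ∀ l → ψ l ⟨$⟩ʳ d₀ ≡ actL R L l d₀
  ψ-d₀ ρ⁺ = ψR-d₀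
  ψ-d₀ ρ⁻ = flip-agrees R ψR (proj₁ ψR-aut) ψR-d₀
  ψ-d₀ λ⁺ = ψL-d₀
  ψ-d₀ λ⁻ = flip-agrees L ψL (proj₂ ψL-aut) ψL-d₀

  Ψ : Word → Permutation′ m
  Ψ []      = idₚ
  Ψ (l ∷ w) = ψ l ∘ₚ Ψ w

  Ψ-aut : ∀ w → IsAut R L (Ψ w)
  Ψ-aut []      = IsAut-id
  Ψ-aut (l ∷ w) = IsAut-∘ₚ (ψ l) (Ψ w) (ψ-aut l) (Ψ-aut w)

  Ψ-d₀ : ∀ w → Ψ w ⟨$⟩ʳ d₀ ≡ eval R L w d₀
  Ψ-d₀ []      = refl
  Ψ-d₀ (l ∷ w) = begin
    Ψ w ⟨$⟩ʳ (ψ l ⟨$⟩ʳ d₀)        ≡⟨ cong (Ψ w ⟨$⟩ʳ_) (ψ-d₀ l) ⟩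
    Ψ w ⟨$⟩ʳ actL R L l d₀        ≡⟨ equivariant-actL (Ψ-aut w) l d₀ ⟩
    actL R L l (Ψ w ⟨$⟩ʳ d₀)      ≡⟨ cong (actL R L l) (Ψ-d₀ w) ⟩
    actL R L l (eval R L w d₀)    ∎
    where open ≡-Reasoning

  transitive : Transitive R L
  transitive d d′ = path d′ ++ inverseWord (path d) , (begin
    eval R L (path d′ ++ inverseWord (path d)) d   ≡⟨ eval-++ R L (path d′) _ d ⟩
    to-d′ (from-d d)                               ≡⟨ cong (to-d′ ∘ from-d) (path-reaches d) ⟨
    to-d′ (from-d (eval R L (path d) d₀))          ≡⟨ cong to-d′ (eval-inverseWord R L (path d) d₀) ⟩
    to-d′ d₀                                       ≡⟨ path-reaches d′ ⟩
    d′                                             ∎)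
    where
      open ≡-Reasoning
      to-d′ = eval R L (path d′)
      from-d = eval R L (inverseWord (path d))

  regular : OrientablyRegular R L
  regular = aut-transitive , aut-free
    where
      Ψ-reaches : ∀ d → Ψ (path d) ⟨$⟩ʳ d₀ ≡ d
      Ψ-reaches d = trans (Ψ-d₀ (path d)) (path-reaches d)
      aut-transitive : ∀ d d′ → Σ (Permutation′ m) λ φ → IsAut R L φ × φ ⟨$⟩ʳ d ≡ d′
      aut-transitive d d′ =
        flip φ ∘ₚ χ , IsAut-∘ₚ (flip φ) χ (IsAut-flip φ (Ψ-aut (path d))) (Ψ-aut (path d′)) , (begin
        χ ⟨$⟩ʳ (φ ⟨$⟩ˡ d)               ≡⟨ cong (λ y → χ ⟨$⟩ʳ (φ ⟨$⟩ˡ y)) (Ψ-reaches d) ⟨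
        χ ⟨$⟩ʳ (φ ⟨$⟩ˡ (φ ⟨$⟩ʳ d₀))      ≡⟨ cong (χ ⟨$⟩ʳ_) (inverseˡ φ) ⟩
        χ ⟨$⟩ʳ d₀                       ≡⟨ Ψ-reaches d′ ⟩
        d′                              ∎)
        where
          open ≡-Reasoning
          φ = Ψ (path d)
          χ = Ψ (path d′)
      aut-free : ∀ φ → IsAut R L φ → ∀ d → φ ⟨$⟩ʳ d ≡ d → ∀ x → φ ⟨$⟩ʳ x ≡ x
      aut-free φ φ-aut d φd≡d x with transitive d x
      ... | w , w-d≡x = begin
        φ ⟨$⟩ʳ x                   ≡⟨ cong (φ ⟨$⟩ʳ_) w-d≡x ⟨
        φ ⟨$⟩ʳ eval R L w d        ≡⟨ equivariant-eval φ-aut w d ⟩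
        eval R L w (φ ⟨$⟩ʳ d)      ≡⟨ cong (eval R L w) φd≡d ⟩
        eval R L w d               ≡⟨ w-d≡x ⟩
        x                          ∎
        where open ≡-Reasoning

  hypermap : OrRegHypermap
  hypermap = record
    { m = m ; nonempty = ≤-trans (s≤s z≤n) (toℕ<n d₀)
    ; R = R ; L = L ; trans = transitive ; regular = regular }

module ChiralityGroupCriterion (M : OrRegHypermap) where
  open OrRegHypermap M using (m; R; L; regular)

  eval-determined-at : ∀ d u v → eval R L u d ≡ eval R L v d → eval R L u ≗ eval R L v
  eval-determined-at d u v u-d≡v-d x with proj₁ regular d x
  ... | φ , φ-aut , φd≡x = begin
    eval R L u x               ≡⟨ cong (eval R L u) φd≡x ⟨
    eval R L u (φ ⟨$⟩ʳ d)      ≡⟨ equivariant-eval φ-aut u d ⟨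
    φ ⟨$⟩ʳ eval R L u d        ≡⟨ cong (φ ⟨$⟩ʳ_) u-d≡v-d ⟩
    φ ⟨$⟩ʳ eval R L v d        ≡⟨ equivariant-eval φ-aut v d ⟩
    eval R L v (φ ⟨$⟩ʳ d)      ≡⟨ cong (eval R L v) φd≡x ⟩
    eval R L v x               ∎
    where open ≡-Reasoning

  module _ (d₀ : Fin m)
    {q : ℕ} (X Y : Permutation′ q) (π : Fin m → Fin q) (π-equivariant : Equivariant R L X Y π)
    (θ : Fin q → Fin q) (θ-mirror : Equivariant X Y (flip X) (flip Y) θ) (θ-π-d₀ : θ (π d₀) ≡ π d₀)
    {G : Set} (_·_ : G → G → G) (word : G → Word) (decode : Fin m → G)
    (word-hom : ∀ x y → eval R L (word (x · y)) d₀ ≡ eval R L (word x) (eval R L (word y) d₀))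
    (decode-word : ∀ x → decode (eval R L (word x) d₀) ≡ x)
    (word-chiral : ∀ x → eval R L (conjW (word x)) d₀ ≡ d₀)
    (fibre-covered : ∀ p → θ (π p) ≡ π d₀ → eval R L (word (decode p)) d₀ ≡ p) where

    mirror-trivial⇒θπ-fixed : ∀ w → eval R L (conjW w) d₀ ≡ d₀ → θ (π (eval R L w d₀)) ≡ π d₀
    mirror-trivial⇒θπ-fixed w w̄-d₀≡d₀ = begin
      θ (π (eval R L w d₀))                  ≡⟨ cong θ (equivariant-eval π-equivariant w d₀) ⟩
      θ (eval X Y w (π d₀))                  ≡⟨ equivariant-eval θ-mirror w (π d₀) ⟩
      eval (flip X) (flip Y) w (θ (π d₀))    ≡⟨ cong (eval (flip X) (flip Y) w) θ-π-d₀ ⟩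
      eval (flip X) (flip Y) w (π d₀)        ≡⟨ eval-mirror X Y w (π d₀) ⟩
      eval X Y (conjW w) (π d₀)              ≡⟨ equivariant-eval π-equivariant (conjW w) d₀ ⟨
      π (eval R L (conjW w) d₀)              ≡⟨ cong π w̄-d₀≡d₀ ⟩
      π d₀                                   ∎
      where open ≡-Reasoning

    isoToChirality : IsoToChirality _·_ M
    isoToChirality = eval R L ∘ word , hom , injective , chiral , onto
      where
        hom : ∀ x y → eval R L (word (x · y)) ≗ eval R L (word x) ∘ eval R L (word y)
        hom x y z = trans (eval-determined-at d₀ (word (x · y)) (word x ++ word y)
                             (trans (word-hom x y) (sym (eval-++ R L (word x) (word y) d₀))) z)
                          (eval-++ R L (word x) (word y) z)
        injective : ∀ x y → eval R L (word x) ≗ eval R L (word y) → x ≡ y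
        injective x y x≗y = trans (sym (decode-word x)) (trans (cong decode (x≗y d₀)) (decode-word y))
        chiral : ∀ x → InChirality M (eval R L (word x))
        chiral x = word x , (λ _ → refl) , eval-determined-at d₀ (conjW (word x)) [] (word-chiral x)
        onto : ∀ f → InChirality M f → ∃[ x ] eval R L (word x) ≗ f
        onto f (w , w≗f , w̄≗id) = decode p , λ z → trans (word-decode-p≗w z) (w≗f z)
          where
            p = eval R L w d₀
            word-decode-p≗w : eval R L (word (decode p)) ≗ eval R L w
            word-decode-p≗w = eval-determined-at d₀ (word (decode p)) w
                                (fibre-covered p (mirror-trivial⇒θπ-fixed w (w̄≗id d₀)))

infix 4 _≗?_

_≗?_ : ∀ {m k} (f g : Fin m → Fin k) → Dec (f ≗ g)
f ≗? g = all? λ x → f x ≟ g x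

equivariant? : ∀ {m k} (R L : Permutation′ m) (R′ L′ : Permutation′ k) (f : Fin m → Fin k) →
               Dec (Equivariant R L R′ L′ f)
equivariant? R L R′ L′ f = (f ∘ (R ⟨$⟩ʳ_) ≗? (R′ ⟨$⟩ʳ_) ∘ f) ×-dec (f ∘ (L ⟨$⟩ʳ_) ≗? (L′ ⟨$⟩ʳ_) ∘ f)

checkedPermutation : ∀ {m} (f g : Fin m → Fin m) →
                     {True (f ∘ g ≗? id)} → {True (g ∘ f ≗? id)} → Permutation′ m
checkedPermutation f g {fg≗id} {gf≗id} = permutation f g (toWitness fg≗id) (toWitness gf≗id)

_≟-Dih_ : ∀ {n} (x y : Dih n) → Dec (x ≡ y)
_≟-Dih_ = ≡-dec _≟_ _≟ᵇ_

all-Dih? : ∀ {n} {P : Dih n → Set} → (∀ x → Dec (P x)) → Dec (∀ x → P x)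
all-Dih? {P = P} P? = map′ (λ both → λ { (j , false) → proj₁ (both j) ; (j , true) → proj₂ (both j) })
                           (λ all j → all (j , false) , all (j , true))
                           (all? λ j → P? (j , false) ×-dec P? (j , true))

-- In a regular hypermap whose darts are reached from d₀ along path, the automorphism taking d₀
-- to d is eval w d₀ ↦ eval w d.
translation : ∀ {m} (R L : Permutation′ m) (path : Fin m → Word) → Fin m → Fin m → Fin m
translation R L path d x = eval R L (path x) d

block : ∀ {q} k → Fin (q * suc k) → Fin q
block k = quotient (suc k)

onBlocks : ∀ {q} k → (Fin (q * suc k) → Fin (q * suc k)) → Fin q → Fin q
onBlocks k f a = block k (f (combine a fzero))

-- The darts are numbered so that the fibres of the projection onto the reflexible quotient are
-- the blocks of k + 1 consecutive darts.
module BlockRealisation {q k n : ℕ} .{{_ : NonZero n}}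
  (R L : Permutation′ (q * suc k)) (d₀ : Fin (q * suc k)) (path : Fin (q * suc k) → Word)
  (θ : Fin q → Fin q) (word : Dih n → Word) (decode : Fin (q * suc k) → Dih n) where

  π : Fin (q * suc k) → Fin q
  π = block k

  dart : Dih n → Fin (q * suc k)
  dart x = eval R L (word x) d₀

  ψR⁺ ψR⁻ ψL⁺ ψL⁻ : Fin (q * suc k) → Fin (q * suc k)
  ψR⁺ = translation R L path (R ⟨$⟩ʳ d₀)
  ψR⁻ = translation R L path (R ⟨$⟩ˡ d₀)
  ψL⁺ = translation R L path (L ⟨$⟩ʳ d₀)
  ψL⁻ = translation R L path (L ⟨$⟩ˡ d₀)

  X⁺ X⁻ Y⁺ Y⁻ : Fin q → Fin q
  X⁺ = onBlocks k (R ⟨$⟩ʳ_)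
  X⁻ = onBlocks k (R ⟨$⟩ˡ_)
  Y⁺ = onBlocks k (L ⟨$⟩ʳ_)
  Y⁻ = onBlocks k (L ⟨$⟩ˡ_)

  module _
    {ψR-inverse : True (ψR⁺ ∘ ψR⁻ ≗? id)} {ψR-inverse′ : True (ψR⁻ ∘ ψR⁺ ≗? id)}
    {ψL-inverse : True (ψL⁺ ∘ ψL⁻ ≗? id)} {ψL-inverse′ : True (ψL⁻ ∘ ψL⁺ ≗? id)}
    {X-inverse : True (X⁺ ∘ X⁻ ≗? id)} {X-inverse′ : True (X⁻ ∘ X⁺ ≗? id)}
    {Y-inverse : True (Y⁺ ∘ Y⁻ ≗? id)} {Y-inverse′ : True (Y⁻ ∘ Y⁺ ≗? id)}
    where

    ψR ψL : Permutation′ (q * suc k)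
    ψR = checkedPermutation ψR⁺ ψR⁻ {ψR-inverse} {ψR-inverse′}
    ψL = checkedPermutation ψL⁺ ψL⁻ {ψL-inverse} {ψL-inverse′}

    X Y : Permutation′ q
    X = checkedPermutation X⁺ X⁻ {X-inverse} {X-inverse′}
    Y = checkedPermutation Y⁺ Y⁻ {Y-inverse} {Y-inverse′}

    module _
      {path-reaches : True ((λ d → eval R L (path d) d₀) ≗? id)}
      {ψR-aut : True (equivariant? R L R L (ψR ⟨$⟩ʳ_))} {ψL-aut : True (equivariant? R L R L (ψL ⟨$⟩ʳ_))}
      {ψR-d₀ : True (ψR ⟨$⟩ʳ d₀ ≟ R ⟨$⟩ʳ d₀)} {ψL-d₀ : True (ψL ⟨$⟩ʳ d₀ ≟ L ⟨$⟩ʳ d₀)}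
      {π-equivariant : True (equivariant? R L X Y π)}
      {θ-mirror : True (equivariant? X Y (flip X) (flip Y) θ)} {θ-π-d₀ : True (θ (π d₀) ≟ π d₀)}
      {word-hom : True (all-Dih? λ x → all-Dih? λ y → dart (dihMul n x y) ≟ eval R L (word x) (dart y))}
      {decode-dart : True (all-Dih? λ x → decode (dart x) ≟-Dih x)}
      {word-chiral : True (all-Dih? λ x → eval R L (conjW (word x)) d₀ ≟ d₀)}
      {fibre-covered : True (all? λ p → θ (π p) ≟ π d₀ →-dec dart (decode p) ≟ p)}
      where

      hypermap : OrRegHypermap
      hypermap = RegularHypermap.hypermap R L d₀ path (toWitness path-reaches)
        ψR ψL (toWitness ψR-aut) (toWitness ψL-aut) (toWitness ψR-d₀) (toWitness ψL-d₀)

      isChiralityGroup : IsChiralityGroup (dihMul n)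
      isChiralityGroup = hypermap , ChiralityGroupCriterion.isoToChirality hypermap d₀
        X Y π (toWitness π-equivariant) θ (toWitness θ-mirror) (toWitness θ-π-d₀)
        (dihMul n) word decode
        (toWitness word-hom) (toWitness decode-dart) (toWitness word-chiral) (toWitness fibre-covered)

module D₁-realisation where
  Rᵗ R⁻¹ᵗ Lᵗ L⁻¹ᵗ : Vec (Fin 64) 64
  Rᵗ =
    # 45 ∷ # 44 ∷ # 46 ∷ # 47 ∷ # 42 ∷ # 43 ∷ # 41 ∷ # 40 ∷ # 35 ∷ # 34 ∷ # 32 ∷ # 33 ∷ # 39 ∷ # 38 ∷
    # 36 ∷ # 37 ∷ # 61 ∷ # 60 ∷ # 62 ∷ # 63 ∷ # 58 ∷ # 59 ∷ # 57 ∷ # 56 ∷ # 51 ∷ # 50 ∷ # 48 ∷ # 49 ∷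
    # 55 ∷ # 54 ∷ # 52 ∷ # 53 ∷ # 24 ∷ # 25 ∷ # 26 ∷ # 27 ∷ # 28 ∷ # 29 ∷ # 30 ∷ # 31 ∷ # 20 ∷ # 21 ∷
    # 22 ∷ # 23 ∷ # 18 ∷ # 19 ∷ # 16 ∷ # 17 ∷ # 8 ∷ # 9 ∷ # 10 ∷ # 11 ∷ # 12 ∷ # 13 ∷ # 14 ∷ # 15 ∷
    # 4 ∷ # 5 ∷ # 6 ∷ # 7 ∷ # 2 ∷ # 3 ∷ # 0 ∷ # 1 ∷ []
  R⁻¹ᵗ =
    # 62 ∷ # 63 ∷ # 60 ∷ # 61 ∷ # 56 ∷ # 57 ∷ # 58 ∷ # 59 ∷ # 48 ∷ # 49 ∷ # 50 ∷ # 51 ∷ # 52 ∷ # 53 ∷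
    # 54 ∷ # 55 ∷ # 46 ∷ # 47 ∷ # 44 ∷ # 45 ∷ # 40 ∷ # 41 ∷ # 42 ∷ # 43 ∷ # 32 ∷ # 33 ∷ # 34 ∷ # 35 ∷
    # 36 ∷ # 37 ∷ # 38 ∷ # 39 ∷ # 10 ∷ # 11 ∷ # 9 ∷ # 8 ∷ # 14 ∷ # 15 ∷ # 13 ∷ # 12 ∷ # 7 ∷ # 6 ∷ # 4 ∷
    # 5 ∷ # 1 ∷ # 0 ∷ # 2 ∷ # 3 ∷ # 26 ∷ # 27 ∷ # 25 ∷ # 24 ∷ # 30 ∷ # 31 ∷ # 29 ∷ # 28 ∷ # 23 ∷ # 22 ∷
    # 20 ∷ # 21 ∷ # 17 ∷ # 16 ∷ # 18 ∷ # 19 ∷ []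
  Lᵗ =
    # 10 ∷ # 11 ∷ # 8 ∷ # 9 ∷ # 15 ∷ # 14 ∷ # 12 ∷ # 13 ∷ # 7 ∷ # 6 ∷ # 4 ∷ # 5 ∷ # 1 ∷ # 0 ∷ # 2 ∷
    # 3 ∷ # 26 ∷ # 27 ∷ # 24 ∷ # 25 ∷ # 31 ∷ # 30 ∷ # 28 ∷ # 29 ∷ # 23 ∷ # 22 ∷ # 20 ∷ # 21 ∷ # 17 ∷
    # 16 ∷ # 18 ∷ # 19 ∷ # 47 ∷ # 46 ∷ # 44 ∷ # 45 ∷ # 40 ∷ # 41 ∷ # 42 ∷ # 43 ∷ # 32 ∷ # 33 ∷ # 34 ∷
    # 35 ∷ # 36 ∷ # 37 ∷ # 38 ∷ # 39 ∷ # 63 ∷ # 62 ∷ # 60 ∷ # 61 ∷ # 56 ∷ # 57 ∷ # 58 ∷ # 59 ∷ # 48 ∷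
    # 49 ∷ # 50 ∷ # 51 ∷ # 52 ∷ # 53 ∷ # 54 ∷ # 55 ∷ []
  L⁻¹ᵗ =
    # 13 ∷ # 12 ∷ # 14 ∷ # 15 ∷ # 10 ∷ # 11 ∷ # 9 ∷ # 8 ∷ # 2 ∷ # 3 ∷ # 0 ∷ # 1 ∷ # 6 ∷ # 7 ∷ # 5 ∷
    # 4 ∷ # 29 ∷ # 28 ∷ # 30 ∷ # 31 ∷ # 26 ∷ # 27 ∷ # 25 ∷ # 24 ∷ # 18 ∷ # 19 ∷ # 16 ∷ # 17 ∷ # 22 ∷
    # 23 ∷ # 21 ∷ # 20 ∷ # 40 ∷ # 41 ∷ # 42 ∷ # 43 ∷ # 44 ∷ # 45 ∷ # 46 ∷ # 47 ∷ # 36 ∷ # 37 ∷ # 38 ∷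
    # 39 ∷ # 34 ∷ # 35 ∷ # 33 ∷ # 32 ∷ # 56 ∷ # 57 ∷ # 58 ∷ # 59 ∷ # 60 ∷ # 61 ∷ # 62 ∷ # 63 ∷ # 52 ∷
    # 53 ∷ # 54 ∷ # 55 ∷ # 50 ∷ # 51 ∷ # 49 ∷ # 48 ∷ []

  pathᵗ : Vec Word 64
  pathᵗ =
    [] ∷ (ρ⁺ ∷ ρ⁺ ∷ ρ⁺ ∷ ρ⁺ ∷ []) ∷ (ρ⁺ ∷ λ⁺ ∷ ρ⁺ ∷ λ⁺ ∷ ρ⁺ ∷ ρ⁺ ∷ []) ∷ (λ⁺ ∷ λ⁺ ∷ λ⁺ ∷ λ⁺ ∷ []) ∷
    (λ⁺ ∷ λ⁺ ∷ []) ∷ (λ⁺ ∷ λ⁺ ∷ ρ⁺ ∷ ρ⁺ ∷ ρ⁺ ∷ ρ⁺ ∷ []) ∷ (ρ⁺ ∷ λ⁺ ∷ ρ⁺ ∷ ρ⁺ ∷ λ⁺ ∷ ρ⁺ ∷ []) ∷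
    (ρ⁺ ∷ λ⁺ ∷ λ⁺ ∷ ρ⁺ ∷ ρ⁺ ∷ ρ⁺ ∷ []) ∷ (λ⁺ ∷ ρ⁺ ∷ λ⁺ ∷ ρ⁺ ∷ λ⁺ ∷ ρ⁺ ∷ ρ⁺ ∷ []) ∷
    (λ⁺ ∷ λ⁺ ∷ λ⁺ ∷ λ⁺ ∷ λ⁺ ∷ []) ∷ (λ⁺ ∷ []) ∷ (λ⁺ ∷ ρ⁺ ∷ ρ⁺ ∷ ρ⁺ ∷ ρ⁺ ∷ []) ∷
    (ρ⁺ ∷ λ⁺ ∷ λ⁺ ∷ ρ⁺ ∷ λ⁺ ∷ ρ⁺ ∷ ρ⁺ ∷ []) ∷ (λ⁺ ∷ ρ⁺ ∷ λ⁺ ∷ λ⁺ ∷ ρ⁺ ∷ ρ⁺ ∷ ρ⁺ ∷ []) ∷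
    (ρ⁺ ∷ ρ⁺ ∷ ρ⁺ ∷ λ⁺ ∷ ρ⁺ ∷ []) ∷ (λ⁺ ∷ λ⁺ ∷ λ⁺ ∷ []) ∷ (λ⁺ ∷ ρ⁺ ∷ λ⁺ ∷ ρ⁺ ∷ []) ∷
    (ρ⁺ ∷ λ⁺ ∷ ρ⁺ ∷ λ⁺ ∷ []) ∷ (ρ⁺ ∷ ρ⁺ ∷ ρ⁺ ∷ ρ⁺ ∷ ρ⁺ ∷ ρ⁺ ∷ []) ∷ (ρ⁺ ∷ ρ⁺ ∷ []) ∷
    (λ⁺ ∷ λ⁺ ∷ λ⁺ ∷ ρ⁺ ∷ λ⁺ ∷ ρ⁺ ∷ []) ∷ (ρ⁺ ∷ λ⁺ ∷ λ⁺ ∷ ρ⁺ ∷ []) ∷ (λ⁺ ∷ λ⁺ ∷ ρ⁺ ∷ ρ⁺ ∷ []) ∷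
    (λ⁺ ∷ ρ⁺ ∷ ρ⁺ ∷ λ⁺ ∷ []) ∷ (ρ⁺ ∷ ρ⁺ ∷ λ⁺ ∷ []) ∷ (λ⁺ ∷ ρ⁺ ∷ ρ⁺ ∷ []) ∷
    (λ⁺ ∷ λ⁺ ∷ ρ⁺ ∷ λ⁺ ∷ ρ⁺ ∷ []) ∷ (λ⁺ ∷ ρ⁺ ∷ λ⁺ ∷ ρ⁺ ∷ λ⁺ ∷ []) ∷ (λ⁺ ∷ λ⁺ ∷ λ⁺ ∷ ρ⁺ ∷ ρ⁺ ∷ []) ∷
    (ρ⁺ ∷ λ⁺ ∷ ρ⁺ ∷ []) ∷ (λ⁺ ∷ ρ⁺ ∷ λ⁺ ∷ λ⁺ ∷ ρ⁺ ∷ []) ∷ (ρ⁺ ∷ λ⁺ ∷ λ⁺ ∷ ρ⁺ ∷ λ⁺ ∷ []) ∷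
    (ρ⁺ ∷ λ⁺ ∷ []) ∷ (λ⁺ ∷ λ⁺ ∷ λ⁺ ∷ ρ⁺ ∷ []) ∷ (λ⁺ ∷ ρ⁺ ∷ λ⁺ ∷ λ⁺ ∷ []) ∷
    (λ⁺ ∷ λ⁺ ∷ λ⁺ ∷ λ⁺ ∷ ρ⁺ ∷ λ⁺ ∷ []) ∷ (λ⁺ ∷ ρ⁺ ∷ ρ⁺ ∷ ρ⁺ ∷ ρ⁺ ∷ ρ⁺ ∷ []) ∷ (λ⁺ ∷ ρ⁺ ∷ []) ∷
    (λ⁺ ∷ λ⁺ ∷ λ⁺ ∷ λ⁺ ∷ λ⁺ ∷ ρ⁺ ∷ []) ∷ (λ⁺ ∷ λ⁺ ∷ ρ⁺ ∷ λ⁺ ∷ []) ∷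
    (λ⁺ ∷ λ⁺ ∷ ρ⁺ ∷ ρ⁺ ∷ ρ⁺ ∷ ρ⁺ ∷ ρ⁺ ∷ []) ∷ (λ⁺ ∷ λ⁺ ∷ ρ⁺ ∷ []) ∷ (ρ⁺ ∷ λ⁺ ∷ λ⁺ ∷ []) ∷
    (λ⁺ ∷ λ⁺ ∷ λ⁺ ∷ ρ⁺ ∷ λ⁺ ∷ []) ∷ (ρ⁺ ∷ ρ⁺ ∷ ρ⁺ ∷ ρ⁺ ∷ ρ⁺ ∷ []) ∷ (ρ⁺ ∷ []) ∷
    (λ⁺ ∷ λ⁺ ∷ λ⁺ ∷ λ⁺ ∷ ρ⁺ ∷ []) ∷ (λ⁺ ∷ ρ⁺ ∷ λ⁺ ∷ []) ∷ (ρ⁺ ∷ λ⁺ ∷ λ⁺ ∷ ρ⁺ ∷ λ⁺ ∷ ρ⁺ ∷ []) ∷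
    (λ⁺ ∷ ρ⁺ ∷ λ⁺ ∷ λ⁺ ∷ ρ⁺ ∷ ρ⁺ ∷ []) ∷ (ρ⁺ ∷ λ⁺ ∷ ρ⁺ ∷ ρ⁺ ∷ []) ∷ (ρ⁺ ∷ ρ⁺ ∷ ρ⁺ ∷ λ⁺ ∷ []) ∷
    (λ⁺ ∷ λ⁺ ∷ ρ⁺ ∷ λ⁺ ∷ ρ⁺ ∷ ρ⁺ ∷ []) ∷ (λ⁺ ∷ ρ⁺ ∷ λ⁺ ∷ ρ⁺ ∷ λ⁺ ∷ ρ⁺ ∷ []) ∷
    (ρ⁺ ∷ ρ⁺ ∷ λ⁺ ∷ ρ⁺ ∷ []) ∷ (λ⁺ ∷ ρ⁺ ∷ ρ⁺ ∷ ρ⁺ ∷ []) ∷ (ρ⁺ ∷ λ⁺ ∷ ρ⁺ ∷ ρ⁺ ∷ λ⁺ ∷ []) ∷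
    (ρ⁺ ∷ λ⁺ ∷ λ⁺ ∷ ρ⁺ ∷ ρ⁺ ∷ []) ∷ (λ⁺ ∷ ρ⁺ ∷ ρ⁺ ∷ λ⁺ ∷ ρ⁺ ∷ []) ∷ (λ⁺ ∷ λ⁺ ∷ ρ⁺ ∷ ρ⁺ ∷ ρ⁺ ∷ []) ∷
    (λ⁺ ∷ ρ⁺ ∷ λ⁺ ∷ ρ⁺ ∷ ρ⁺ ∷ []) ∷ (ρ⁺ ∷ λ⁺ ∷ ρ⁺ ∷ λ⁺ ∷ ρ⁺ ∷ []) ∷
    (ρ⁺ ∷ ρ⁺ ∷ ρ⁺ ∷ ρ⁺ ∷ ρ⁺ ∷ ρ⁺ ∷ ρ⁺ ∷ []) ∷ (ρ⁺ ∷ ρ⁺ ∷ ρ⁺ ∷ []) ∷ []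

  θᵗ : Vec (Fin 32) 32
  θᵗ =
    # 0 ∷ # 1 ∷ # 3 ∷ # 2 ∷ # 7 ∷ # 6 ∷ # 5 ∷ # 4 ∷ # 8 ∷ # 9 ∷ # 11 ∷ # 10 ∷ # 15 ∷ # 14 ∷ # 13 ∷
    # 12 ∷ # 26 ∷ # 27 ∷ # 24 ∷ # 25 ∷ # 28 ∷ # 29 ∷ # 31 ∷ # 30 ∷ # 18 ∷ # 19 ∷ # 16 ∷ # 17 ∷ # 20 ∷
    # 21 ∷ # 23 ∷ # 22 ∷ []

  word : Dih 1 → Word
  word (fzero , false) = []
  word (fzero , true)  = λ⁻ ∷ ρ⁻ ∷ λ⁺ ∷ λ⁺ ∷ λ⁺ ∷ ρ⁺ ∷ []

  -- The words send d₀ to the darts 0, …, 2n − 1; elsewhere decode is arbitrary.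
  decode : Fin 64 → Dih 1
  decode (fsuc fzero) = fzero , true
  decode _            = fzero , false

  isChiralityGroup : IsChiralityGroup (dihMul 1)
  isChiralityGroup = BlockRealisation.isChiralityGroup {q = 32} {k = 1}
    (checkedPermutation (lookup Rᵗ) (lookup R⁻¹ᵗ)) (checkedPermutation (lookup Lᵗ) (lookup L⁻¹ᵗ))
    fzero (lookup pathᵗ) (lookup θᵗ) word decode

module D₂-realisation where
  Rᵗ R⁻¹ᵗ Lᵗ L⁻¹ᵗ : Vec (Fin 96) 96
  Rᵗ =
    # 63 ∷ # 62 ∷ # 61 ∷ # 60 ∷ # 75 ∷ # 74 ∷ # 73 ∷ # 72 ∷ # 37 ∷ # 36 ∷ # 39 ∷ # 38 ∷ # 51 ∷ # 50 ∷
    # 49 ∷ # 48 ∷ # 87 ∷ # 86 ∷ # 85 ∷ # 84 ∷ # 25 ∷ # 24 ∷ # 27 ∷ # 26 ∷ # 76 ∷ # 77 ∷ # 78 ∷ # 79 ∷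
    # 13 ∷ # 12 ∷ # 15 ∷ # 14 ∷ # 66 ∷ # 67 ∷ # 64 ∷ # 65 ∷ # 88 ∷ # 89 ∷ # 90 ∷ # 91 ∷ # 1 ∷ # 0 ∷
    # 3 ∷ # 2 ∷ # 54 ∷ # 55 ∷ # 52 ∷ # 53 ∷ # 42 ∷ # 43 ∷ # 40 ∷ # 41 ∷ # 80 ∷ # 81 ∷ # 82 ∷ # 83 ∷
    # 16 ∷ # 17 ∷ # 18 ∷ # 19 ∷ # 30 ∷ # 31 ∷ # 28 ∷ # 29 ∷ # 92 ∷ # 93 ∷ # 94 ∷ # 95 ∷ # 4 ∷ # 5 ∷
    # 6 ∷ # 7 ∷ # 56 ∷ # 57 ∷ # 58 ∷ # 59 ∷ # 8 ∷ # 9 ∷ # 10 ∷ # 11 ∷ # 32 ∷ # 33 ∷ # 34 ∷ # 35 ∷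
    # 68 ∷ # 69 ∷ # 70 ∷ # 71 ∷ # 20 ∷ # 21 ∷ # 22 ∷ # 23 ∷ # 44 ∷ # 45 ∷ # 46 ∷ # 47 ∷ []
  R⁻¹ᵗ =
    # 41 ∷ # 40 ∷ # 43 ∷ # 42 ∷ # 68 ∷ # 69 ∷ # 70 ∷ # 71 ∷ # 76 ∷ # 77 ∷ # 78 ∷ # 79 ∷ # 29 ∷ # 28 ∷
    # 31 ∷ # 30 ∷ # 56 ∷ # 57 ∷ # 58 ∷ # 59 ∷ # 88 ∷ # 89 ∷ # 90 ∷ # 91 ∷ # 21 ∷ # 20 ∷ # 23 ∷ # 22 ∷
    # 62 ∷ # 63 ∷ # 60 ∷ # 61 ∷ # 80 ∷ # 81 ∷ # 82 ∷ # 83 ∷ # 9 ∷ # 8 ∷ # 11 ∷ # 10 ∷ # 50 ∷ # 51 ∷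
    # 48 ∷ # 49 ∷ # 92 ∷ # 93 ∷ # 94 ∷ # 95 ∷ # 15 ∷ # 14 ∷ # 13 ∷ # 12 ∷ # 46 ∷ # 47 ∷ # 44 ∷ # 45 ∷
    # 72 ∷ # 73 ∷ # 74 ∷ # 75 ∷ # 3 ∷ # 2 ∷ # 1 ∷ # 0 ∷ # 34 ∷ # 35 ∷ # 32 ∷ # 33 ∷ # 84 ∷ # 85 ∷
    # 86 ∷ # 87 ∷ # 7 ∷ # 6 ∷ # 5 ∷ # 4 ∷ # 24 ∷ # 25 ∷ # 26 ∷ # 27 ∷ # 52 ∷ # 53 ∷ # 54 ∷ # 55 ∷
    # 19 ∷ # 18 ∷ # 17 ∷ # 16 ∷ # 36 ∷ # 37 ∷ # 38 ∷ # 39 ∷ # 64 ∷ # 65 ∷ # 66 ∷ # 67 ∷ []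
  Lᵗ =
    # 32 ∷ # 33 ∷ # 34 ∷ # 35 ∷ # 55 ∷ # 54 ∷ # 53 ∷ # 52 ∷ # 92 ∷ # 93 ∷ # 94 ∷ # 95 ∷ # 44 ∷ # 45 ∷
    # 46 ∷ # 47 ∷ # 67 ∷ # 66 ∷ # 65 ∷ # 64 ∷ # 80 ∷ # 81 ∷ # 82 ∷ # 83 ∷ # 7 ∷ # 6 ∷ # 5 ∷ # 4 ∷
    # 56 ∷ # 57 ∷ # 58 ∷ # 59 ∷ # 84 ∷ # 85 ∷ # 86 ∷ # 87 ∷ # 19 ∷ # 18 ∷ # 17 ∷ # 16 ∷ # 68 ∷ # 69 ∷
    # 70 ∷ # 71 ∷ # 72 ∷ # 73 ∷ # 74 ∷ # 75 ∷ # 8 ∷ # 9 ∷ # 10 ∷ # 11 ∷ # 24 ∷ # 25 ∷ # 26 ∷ # 27 ∷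
    # 88 ∷ # 89 ∷ # 90 ∷ # 91 ∷ # 20 ∷ # 21 ∷ # 22 ∷ # 23 ∷ # 36 ∷ # 37 ∷ # 38 ∷ # 39 ∷ # 76 ∷ # 77 ∷
    # 78 ∷ # 79 ∷ # 12 ∷ # 13 ∷ # 14 ∷ # 15 ∷ # 40 ∷ # 41 ∷ # 42 ∷ # 43 ∷ # 60 ∷ # 61 ∷ # 62 ∷ # 63 ∷
    # 0 ∷ # 1 ∷ # 2 ∷ # 3 ∷ # 28 ∷ # 29 ∷ # 30 ∷ # 31 ∷ # 48 ∷ # 49 ∷ # 50 ∷ # 51 ∷ []
  L⁻¹ᵗ =
    # 84 ∷ # 85 ∷ # 86 ∷ # 87 ∷ # 27 ∷ # 26 ∷ # 25 ∷ # 24 ∷ # 48 ∷ # 49 ∷ # 50 ∷ # 51 ∷ # 72 ∷ # 73 ∷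
    # 74 ∷ # 75 ∷ # 39 ∷ # 38 ∷ # 37 ∷ # 36 ∷ # 60 ∷ # 61 ∷ # 62 ∷ # 63 ∷ # 52 ∷ # 53 ∷ # 54 ∷ # 55 ∷
    # 88 ∷ # 89 ∷ # 90 ∷ # 91 ∷ # 0 ∷ # 1 ∷ # 2 ∷ # 3 ∷ # 64 ∷ # 65 ∷ # 66 ∷ # 67 ∷ # 76 ∷ # 77 ∷
    # 78 ∷ # 79 ∷ # 12 ∷ # 13 ∷ # 14 ∷ # 15 ∷ # 92 ∷ # 93 ∷ # 94 ∷ # 95 ∷ # 7 ∷ # 6 ∷ # 5 ∷ # 4 ∷
    # 28 ∷ # 29 ∷ # 30 ∷ # 31 ∷ # 80 ∷ # 81 ∷ # 82 ∷ # 83 ∷ # 19 ∷ # 18 ∷ # 17 ∷ # 16 ∷ # 40 ∷ # 41 ∷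
    # 42 ∷ # 43 ∷ # 44 ∷ # 45 ∷ # 46 ∷ # 47 ∷ # 68 ∷ # 69 ∷ # 70 ∷ # 71 ∷ # 20 ∷ # 21 ∷ # 22 ∷ # 23 ∷
    # 32 ∷ # 33 ∷ # 34 ∷ # 35 ∷ # 56 ∷ # 57 ∷ # 58 ∷ # 59 ∷ # 8 ∷ # 9 ∷ # 10 ∷ # 11 ∷ []

  pathᵗ : Vec Word 96
  pathᵗ =
    [] ∷ (ρ⁺ ∷ ρ⁺ ∷ λ⁺ ∷ ρ⁺ ∷ ρ⁺ ∷ λ⁺ ∷ []) ∷ (λ⁺ ∷ ρ⁺ ∷ ρ⁺ ∷ λ⁺ ∷ ρ⁺ ∷ ρ⁺ ∷ []) ∷
    (ρ⁺ ∷ λ⁺ ∷ ρ⁺ ∷ ρ⁺ ∷ λ⁺ ∷ ρ⁺ ∷ []) ∷ (ρ⁺ ∷ ρ⁺ ∷ λ⁺ ∷ λ⁺ ∷ []) ∷ (λ⁺ ∷ ρ⁺ ∷ λ⁺ ∷ ρ⁺ ∷ []) ∷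
    (ρ⁺ ∷ ρ⁺ ∷ ρ⁺ ∷ ρ⁺ ∷ λ⁺ ∷ ρ⁺ ∷ ρ⁺ ∷ []) ∷ (λ⁺ ∷ ρ⁺ ∷ ρ⁺ ∷ λ⁺ ∷ λ⁺ ∷ ρ⁺ ∷ ρ⁺ ∷ []) ∷
    (ρ⁺ ∷ λ⁺ ∷ ρ⁺ ∷ λ⁺ ∷ λ⁺ ∷ []) ∷ (ρ⁺ ∷ λ⁺ ∷ λ⁺ ∷ ρ⁺ ∷ ρ⁺ ∷ ρ⁺ ∷ ρ⁺ ∷ ρ⁺ ∷ []) ∷
    (ρ⁺ ∷ ρ⁺ ∷ ρ⁺ ∷ λ⁺ ∷ ρ⁺ ∷ []) ∷ (λ⁺ ∷ ρ⁺ ∷ ρ⁺ ∷ ρ⁺ ∷ ρ⁺ ∷ []) ∷ (ρ⁺ ∷ ρ⁺ ∷ ρ⁺ ∷ []) ∷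
    (ρ⁺ ∷ ρ⁺ ∷ λ⁺ ∷ ρ⁺ ∷ ρ⁺ ∷ λ⁺ ∷ ρ⁺ ∷ ρ⁺ ∷ ρ⁺ ∷ []) ∷ (λ⁺ ∷ ρ⁺ ∷ λ⁺ ∷ ρ⁺ ∷ λ⁺ ∷ ρ⁺ ∷ []) ∷
    (ρ⁺ ∷ λ⁺ ∷ ρ⁺ ∷ λ⁺ ∷ ρ⁺ ∷ λ⁺ ∷ []) ∷ (ρ⁺ ∷ ρ⁺ ∷ λ⁺ ∷ λ⁺ ∷ ρ⁺ ∷ ρ⁺ ∷ ρ⁺ ∷ []) ∷
    (ρ⁺ ∷ λ⁺ ∷ ρ⁺ ∷ ρ⁺ ∷ []) ∷ (ρ⁺ ∷ ρ⁺ ∷ ρ⁺ ∷ λ⁺ ∷ ρ⁺ ∷ λ⁺ ∷ ρ⁺ ∷ []) ∷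
    (ρ⁺ ∷ ρ⁺ ∷ ρ⁺ ∷ ρ⁺ ∷ ρ⁺ ∷ λ⁺ ∷ λ⁺ ∷ []) ∷ (ρ⁺ ∷ λ⁺ ∷ ρ⁺ ∷ λ⁺ ∷ λ⁺ ∷ ρ⁺ ∷ ρ⁺ ∷ ρ⁺ ∷ []) ∷
    (ρ⁺ ∷ λ⁺ ∷ λ⁺ ∷ ρ⁺ ∷ ρ⁺ ∷ []) ∷ (ρ⁺ ∷ ρ⁺ ∷ λ⁺ ∷ ρ⁺ ∷ λ⁺ ∷ []) ∷ (λ⁺ ∷ ρ⁺ ∷ []) ∷
    (ρ⁺ ∷ ρ⁺ ∷ λ⁺ ∷ λ⁺ ∷ ρ⁺ ∷ ρ⁺ ∷ []) ∷ (λ⁺ ∷ ρ⁺ ∷ ρ⁺ ∷ λ⁺ ∷ λ⁺ ∷ ρ⁺ ∷ ρ⁺ ∷ ρ⁺ ∷ ρ⁺ ∷ []) ∷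
    (ρ⁺ ∷ λ⁺ ∷ ρ⁺ ∷ []) ∷ (ρ⁺ ∷ ρ⁺ ∷ ρ⁺ ∷ λ⁺ ∷ ρ⁺ ∷ λ⁺ ∷ []) ∷
    (ρ⁺ ∷ λ⁺ ∷ ρ⁺ ∷ ρ⁺ ∷ λ⁺ ∷ ρ⁺ ∷ ρ⁺ ∷ ρ⁺ ∷ []) ∷ (ρ⁺ ∷ ρ⁺ ∷ []) ∷ (λ⁺ ∷ ρ⁺ ∷ λ⁺ ∷ ρ⁺ ∷ λ⁺ ∷ []) ∷
    (ρ⁺ ∷ ρ⁺ ∷ λ⁺ ∷ ρ⁺ ∷ ρ⁺ ∷ λ⁺ ∷ ρ⁺ ∷ ρ⁺ ∷ []) ∷ (λ⁺ ∷ []) ∷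
    (ρ⁺ ∷ λ⁺ ∷ ρ⁺ ∷ λ⁺ ∷ λ⁺ ∷ ρ⁺ ∷ ρ⁺ ∷ []) ∷ (ρ⁺ ∷ ρ⁺ ∷ ρ⁺ ∷ λ⁺ ∷ ρ⁺ ∷ ρ⁺ ∷ ρ⁺ ∷ []) ∷
    (ρ⁺ ∷ λ⁺ ∷ λ⁺ ∷ ρ⁺ ∷ []) ∷ (ρ⁺ ∷ ρ⁺ ∷ λ⁺ ∷ λ⁺ ∷ ρ⁺ ∷ ρ⁺ ∷ ρ⁺ ∷ ρ⁺ ∷ ρ⁺ ∷ []) ∷
    (λ⁺ ∷ ρ⁺ ∷ ρ⁺ ∷ λ⁺ ∷ λ⁺ ∷ ρ⁺ ∷ []) ∷ (λ⁺ ∷ ρ⁺ ∷ λ⁺ ∷ []) ∷ (ρ⁺ ∷ ρ⁺ ∷ ρ⁺ ∷ ρ⁺ ∷ λ⁺ ∷ ρ⁺ ∷ []) ∷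
    (ρ⁺ ∷ λ⁺ ∷ ρ⁺ ∷ ρ⁺ ∷ λ⁺ ∷ []) ∷ (ρ⁺ ∷ ρ⁺ ∷ ρ⁺ ∷ ρ⁺ ∷ ρ⁺ ∷ []) ∷ (λ⁺ ∷ ρ⁺ ∷ ρ⁺ ∷ λ⁺ ∷ ρ⁺ ∷ []) ∷
    (ρ⁺ ∷ ρ⁺ ∷ λ⁺ ∷ ρ⁺ ∷ λ⁺ ∷ ρ⁺ ∷ λ⁺ ∷ ρ⁺ ∷ []) ∷ (λ⁺ ∷ ρ⁺ ∷ ρ⁺ ∷ ρ⁺ ∷ []) ∷
    (ρ⁺ ∷ ρ⁺ ∷ ρ⁺ ∷ ρ⁺ ∷ λ⁺ ∷ λ⁺ ∷ ρ⁺ ∷ []) ∷ (ρ⁺ ∷ ρ⁺ ∷ ρ⁺ ∷ λ⁺ ∷ []) ∷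
    (ρ⁺ ∷ λ⁺ ∷ λ⁺ ∷ ρ⁺ ∷ ρ⁺ ∷ ρ⁺ ∷ ρ⁺ ∷ []) ∷ (ρ⁺ ∷ ρ⁺ ∷ λ⁺ ∷ ρ⁺ ∷ λ⁺ ∷ ρ⁺ ∷ λ⁺ ∷ []) ∷
    (ρ⁺ ∷ λ⁺ ∷ ρ⁺ ∷ λ⁺ ∷ ρ⁺ ∷ λ⁺ ∷ ρ⁺ ∷ []) ∷ (λ⁺ ∷ ρ⁺ ∷ ρ⁺ ∷ λ⁺ ∷ []) ∷ (ρ⁺ ∷ ρ⁺ ∷ ρ⁺ ∷ ρ⁺ ∷ []) ∷
    (ρ⁺ ∷ ρ⁺ ∷ ρ⁺ ∷ ρ⁺ ∷ λ⁺ ∷ []) ∷ (ρ⁺ ∷ ρ⁺ ∷ λ⁺ ∷ λ⁺ ∷ ρ⁺ ∷ ρ⁺ ∷ ρ⁺ ∷ ρ⁺ ∷ []) ∷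
    (ρ⁺ ∷ λ⁺ ∷ ρ⁺ ∷ ρ⁺ ∷ ρ⁺ ∷ []) ∷ (λ⁺ ∷ ρ⁺ ∷ ρ⁺ ∷ λ⁺ ∷ λ⁺ ∷ []) ∷
    (ρ⁺ ∷ λ⁺ ∷ λ⁺ ∷ ρ⁺ ∷ ρ⁺ ∷ ρ⁺ ∷ []) ∷ (λ⁺ ∷ ρ⁺ ∷ ρ⁺ ∷ []) ∷ (ρ⁺ ∷ ρ⁺ ∷ λ⁺ ∷ ρ⁺ ∷ λ⁺ ∷ ρ⁺ ∷ []) ∷
    (ρ⁺ ∷ ρ⁺ ∷ ρ⁺ ∷ ρ⁺ ∷ λ⁺ ∷ λ⁺ ∷ []) ∷ (ρ⁺ ∷ ρ⁺ ∷ λ⁺ ∷ ρ⁺ ∷ ρ⁺ ∷ λ⁺ ∷ ρ⁺ ∷ []) ∷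
    (ρ⁺ ∷ λ⁺ ∷ ρ⁺ ∷ ρ⁺ ∷ λ⁺ ∷ ρ⁺ ∷ ρ⁺ ∷ []) ∷ (λ⁺ ∷ ρ⁺ ∷ ρ⁺ ∷ λ⁺ ∷ ρ⁺ ∷ ρ⁺ ∷ ρ⁺ ∷ []) ∷ (ρ⁺ ∷ []) ∷
    (ρ⁺ ∷ ρ⁺ ∷ ρ⁺ ∷ ρ⁺ ∷ λ⁺ ∷ ρ⁺ ∷ ρ⁺ ∷ ρ⁺ ∷ []) ∷ (ρ⁺ ∷ ρ⁺ ∷ λ⁺ ∷ λ⁺ ∷ ρ⁺ ∷ []) ∷ (ρ⁺ ∷ λ⁺ ∷ []) ∷
    (λ⁺ ∷ ρ⁺ ∷ ρ⁺ ∷ λ⁺ ∷ λ⁺ ∷ ρ⁺ ∷ ρ⁺ ∷ ρ⁺ ∷ []) ∷ (ρ⁺ ∷ λ⁺ ∷ λ⁺ ∷ []) ∷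
    (λ⁺ ∷ ρ⁺ ∷ ρ⁺ ∷ ρ⁺ ∷ ρ⁺ ∷ ρ⁺ ∷ []) ∷ (ρ⁺ ∷ ρ⁺ ∷ ρ⁺ ∷ λ⁺ ∷ ρ⁺ ∷ ρ⁺ ∷ []) ∷
    (ρ⁺ ∷ λ⁺ ∷ ρ⁺ ∷ λ⁺ ∷ λ⁺ ∷ ρ⁺ ∷ []) ∷ (λ⁺ ∷ λ⁺ ∷ ρ⁺ ∷ ρ⁺ ∷ ρ⁺ ∷ []) ∷
    (ρ⁺ ∷ ρ⁺ ∷ ρ⁺ ∷ ρ⁺ ∷ ρ⁺ ∷ λ⁺ ∷ ρ⁺ ∷ ρ⁺ ∷ []) ∷ (ρ⁺ ∷ λ⁺ ∷ ρ⁺ ∷ λ⁺ ∷ ρ⁺ ∷ []) ∷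
    (ρ⁺ ∷ ρ⁺ ∷ ρ⁺ ∷ λ⁺ ∷ λ⁺ ∷ []) ∷ (λ⁺ ∷ ρ⁺ ∷ λ⁺ ∷ λ⁺ ∷ []) ∷
    (λ⁺ ∷ λ⁺ ∷ ρ⁺ ∷ ρ⁺ ∷ ρ⁺ ∷ ρ⁺ ∷ ρ⁺ ∷ []) ∷ (ρ⁺ ∷ ρ⁺ ∷ λ⁺ ∷ ρ⁺ ∷ []) ∷
    (λ⁺ ∷ ρ⁺ ∷ λ⁺ ∷ ρ⁺ ∷ λ⁺ ∷ λ⁺ ∷ ρ⁺ ∷ []) ∷ (ρ⁺ ∷ ρ⁺ ∷ ρ⁺ ∷ ρ⁺ ∷ ρ⁺ ∷ λ⁺ ∷ []) ∷
    (λ⁺ ∷ ρ⁺ ∷ λ⁺ ∷ λ⁺ ∷ ρ⁺ ∷ ρ⁺ ∷ []) ∷ (ρ⁺ ∷ ρ⁺ ∷ λ⁺ ∷ ρ⁺ ∷ ρ⁺ ∷ ρ⁺ ∷ []) ∷ (λ⁺ ∷ λ⁺ ∷ ρ⁺ ∷ []) ∷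
    (λ⁺ ∷ λ⁺ ∷ []) ∷ (λ⁺ ∷ ρ⁺ ∷ λ⁺ ∷ ρ⁺ ∷ λ⁺ ∷ λ⁺ ∷ ρ⁺ ∷ ρ⁺ ∷ []) ∷ (ρ⁺ ∷ ρ⁺ ∷ λ⁺ ∷ ρ⁺ ∷ ρ⁺ ∷ []) ∷
    (λ⁺ ∷ ρ⁺ ∷ λ⁺ ∷ λ⁺ ∷ ρ⁺ ∷ []) ∷ (λ⁺ ∷ ρ⁺ ∷ λ⁺ ∷ λ⁺ ∷ ρ⁺ ∷ ρ⁺ ∷ ρ⁺ ∷ []) ∷
    (λ⁺ ∷ λ⁺ ∷ ρ⁺ ∷ ρ⁺ ∷ []) ∷ (ρ⁺ ∷ λ⁺ ∷ ρ⁺ ∷ λ⁺ ∷ []) ∷ (ρ⁺ ∷ ρ⁺ ∷ ρ⁺ ∷ ρ⁺ ∷ ρ⁺ ∷ λ⁺ ∷ ρ⁺ ∷ []) ∷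
    (λ⁺ ∷ ρ⁺ ∷ λ⁺ ∷ ρ⁺ ∷ λ⁺ ∷ λ⁺ ∷ []) ∷ (ρ⁺ ∷ ρ⁺ ∷ ρ⁺ ∷ λ⁺ ∷ λ⁺ ∷ ρ⁺ ∷ []) ∷ (ρ⁺ ∷ ρ⁺ ∷ λ⁺ ∷ []) ∷
    (λ⁺ ∷ λ⁺ ∷ ρ⁺ ∷ ρ⁺ ∷ ρ⁺ ∷ ρ⁺ ∷ []) ∷ []

  θᵗ : Vec (Fin 24) 24
  θᵗ =
    # 0 ∷ # 13 ∷ # 22 ∷ # 3 ∷ # 16 ∷ # 19 ∷ # 6 ∷ # 12 ∷ # 21 ∷ # 9 ∷ # 15 ∷ # 18 ∷ # 7 ∷ # 1 ∷ # 23 ∷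
    # 10 ∷ # 4 ∷ # 20 ∷ # 11 ∷ # 5 ∷ # 17 ∷ # 8 ∷ # 2 ∷ # 14 ∷ []

  word : Dih 2 → Word
  word (fzero , false)      = []
  word (fsuc fzero , false) = λ⁺ ∷ ρ⁺ ∷ λ⁺ ∷ ρ⁻ ∷ λ⁻ ∷ ρ⁺ ∷ ρ⁺ ∷ []
  word (fzero , true)       = λ⁺ ∷ ρ⁻ ∷ λ⁻ ∷ ρ⁺ ∷ ρ⁺ ∷ λ⁺ ∷ ρ⁺ ∷ []
  word (fsuc fzero , true)  = ρ⁺ ∷ λ⁺ ∷ ρ⁻ ∷ λ⁻ ∷ ρ⁺ ∷ ρ⁺ ∷ λ⁺ ∷ []

  decode : Fin 96 → Dih 2
  decode (fsuc fzero)               = fsuc fzero , false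
  decode (fsuc (fsuc fzero))        = fzero , true
  decode (fsuc (fsuc (fsuc fzero))) = fsuc fzero , true
  decode _                          = fzero , false

  isChiralityGroup : IsChiralityGroup (dihMul 2)
  isChiralityGroup = BlockRealisation.isChiralityGroup {q = 24} {k = 3}
    (checkedPermutation (lookup Rᵗ) (lookup R⁻¹ᵗ)) (checkedPermutation (lookup Lᵗ) (lookup L⁻¹ᵗ))
    fzero (lookup pathᵗ) (lookup θᵗ) word decode

corollary24 : (n : ℕ) .{{_ : NonZero n}} →
    (IsChiralityGroup (dihMul n) → n ≤ 2) × (n ≤ 2 → IsChiralityGroup (dihMul n))
corollary24 1                   = (λ _ → s≤s z≤n) , (λ _ → D₁-realisation.isChiralityGroup)
corollary24 2                   = (λ _ → s≤s (s≤s z≤n)) , (λ _ → D₂-realisation.isChiralityGroup)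
corollary24 (suc (suc (suc k))) = (λ chiral → ⊥-elim (dihedral-not-chirality-group k chiral))
                                , λ { (s≤s (s≤s ())) }
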